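{- Let $T=(T,\eta,\mu)$ be a monad on a category $\mathcal{A}$ and $X$ an object of $\mathcal{A}$. Giving a $T$-algebra $a\colon T(X)\to X$ together with a $\overline{T}$-coalgebra $b$ on $a$ is the same as giving a map $c\colon X\to T(X)$ in $\mathcal{A}$ which is an equaliser in $\mathcal{A}$ of the pair $T(c),T(\eta_X)\colon T(X)\rightrightarrows T^2(X)$. (Given $(a,b)$, $c=b$ is such an equaliser; conversely given such $c$, the algebra $a$ is the unique map with $c\circ a=\mu_X\circ T(c)$, and $c$ is then a $\overline{T}$-coalgebra on $a$.)
   Context: $\mathrm{Alg}(T)$ is the category of Eilenberg–Moore algebras of $T$; the induced comonad $\overline{T}$ on $\mathrm{Alg}(T)$ sends an algebra $a\colon TX\to X$ to the free algebra $\mu_X\colon T^2X\to TX$, with counit $a\colon\mu_X\to a$ and comultiplication $T(\eta_X)\colon\mu_X\to\mu_{TX}$. A $\overline{T}$-coalgebra on an algebra $a\colon TX\to X$ is a map $b\colon X\to TX$ in $\mathcal{A}$ satisfying $b\circ a=\mu_X\circ T(b)$, $a\circ b=\mathrm{id}_X$ and $T(\eta_X)\circ b=T(b)\circ b$. -}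

module Defs where

open import Level using (Level; _⊔_; suc)
open import Data.Product using (Σ; _×_; _,_)
open import Relation.Binary using (IsEquivalence)

record Category (o ℓ e : Level) : Set (suc (o ⊔ ℓ ⊔ e)) where
  infixr 9 _∘_
  infix  4 _≈_
  field
    Obj     : Set o
    Hom     : Obj → Obj → Set ℓ
    _≈_     : ∀ {A B} → Hom A B → Hom A B → Set e
    id      : ∀ {A} → Hom A A
    _∘_     : ∀ {A B C} → Hom B C → Hom A B → Hom A C
    ≈-equiv : ∀ {A B} → IsEquivalence (_≈_ {A} {B})
    ∘-resp-≈ : ∀ {A B C} {f h : Hom B C} {g i : Hom A B} →
               f ≈ h → g ≈ i → f ∘ g ≈ h ∘ i
    assoc   : ∀ {A B C D} {f : Hom A B} {g : Hom B C} {h : Hom C D} →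
              (h ∘ g) ∘ f ≈ h ∘ (g ∘ f)
    identityˡ : ∀ {A B} {f : Hom A B} → id ∘ f ≈ f
    identityʳ : ∀ {A B} {f : Hom A B} → f ∘ id ≈ f

record Endofunctor {o ℓ e} (C : Category o ℓ e) : Set (o ⊔ ℓ ⊔ e) where
  open Category C
  field
    F₀ : Obj → Obj
    F₁ : ∀ {A B} → Hom A B → Hom (F₀ A) (F₀ B)
    F-resp-≈ : ∀ {A B} {f g : Hom A B} → f ≈ g → F₁ f ≈ F₁ g
    F-identity : ∀ {A} → F₁ (id {A}) ≈ id
    F-homomorphism : ∀ {A B C} {f : Hom A B} {g : Hom B C} →
                     F₁ (g ∘ f) ≈ F₁ g ∘ F₁ f

record Monad {o ℓ e} (C : Category o ℓ e) : Set (o ⊔ ℓ ⊔ e) where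
  open Category C
  field
    F : Endofunctor C
  open Endofunctor F public
  field
    η : ∀ X → Hom X (F₀ X)
    μ : ∀ X → Hom (F₀ (F₀ X)) (F₀ X)
    η-natural : ∀ {X Y} {f : Hom X Y} → η Y ∘ f ≈ F₁ f ∘ η X
    μ-natural : ∀ {X Y} {f : Hom X Y} → μ Y ∘ F₁ (F₁ f) ≈ F₁ f ∘ μ X
    μ-assoc   : ∀ {X} → μ X ∘ F₁ (μ X) ≈ μ X ∘ μ (F₀ X)
    μ-identityˡ : ∀ {X} → μ X ∘ F₁ (η X) ≈ id
    μ-identityʳ : ∀ {X} → μ X ∘ η (F₀ X) ≈ id

module _ {o ℓ e} {C : Category o ℓ e} where
  open Category C

  record IsEqualiser {E A B : Obj} (ι : Hom E A) (f g : Hom A B)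
         : Set (o ⊔ ℓ ⊔ e) where
    field
      equality : f ∘ ι ≈ g ∘ ι
      universal : ∀ {Z} (h : Hom Z A) → f ∘ h ≈ g ∘ h →
                  Σ (Hom Z E) (λ u → (ι ∘ u ≈ h) ×
                    (∀ (v : Hom Z E) → ι ∘ v ≈ h → v ≈ u))

  module _ (M : Monad C) where
    open Monad M

    record IsAlgebra {X : Obj} (a : Hom (F₀ X) X) : Set e where
      field
        unit : a ∘ η X ≈ id
        mult : a ∘ F₁ a ≈ a ∘ μ X

    record IsCoalgebraOn {X : Obj} (a : Hom (F₀ X) X) (b : Hom X (F₀ X))
           : Set e where
      field
        hom    : b ∘ a ≈ μ X ∘ F₁ b
        counit : a ∘ b ≈ id
        coassoc : F₁ (η X) ∘ b ≈ F₁ b ∘ b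

module Submission where

open import Data.Product using (Σ; _×_; _,_; proj₁; proj₂)
open import Relation.Binary using (IsEquivalence; Setoid)
import Relation.Binary.Reasoning.Setoid as SetoidReasoning
open import Defs

-- Given (a, b), the maps a and μ_X split the fork b ⇉ T b, T η_X, so b is a split equaliser.
-- Conversely μ_X ∘ T c equalises T c, T η_X because Kleisli extension preserves forks, which
-- yields a; every algebra and coalgebra law for (a, c) is then checked after composing with
-- the monomorphism c.

module CategoryProperties {o ℓ e} (C : Category o ℓ e) where
  open Category C

  private
    module ≈ {A B} = IsEquivalence (≈-equiv {A} {B})

  hom-setoid : Obj → Obj → Setoid ℓ e
  hom-setoid A B = record { Carrier = Hom A B ; _≈_ = _≈_ ; isEquivalence = ≈-equiv }

  module HomReasoning {A B : Obj} = SetoidReasoning (hom-setoid A B)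

  refl⟩∘⟨_ : ∀ {A B D} {f : Hom B D} {g i : Hom A B} → g ≈ i → f ∘ g ≈ f ∘ i
  refl⟩∘⟨ p = ∘-resp-≈ ≈.refl p

  _⟩∘⟨refl : ∀ {A B D} {f h : Hom B D} {g : Hom A B} → f ≈ h → f ∘ g ≈ h ∘ g
  p ⟩∘⟨refl = ∘-resp-≈ p ≈.refl

  infixr 4 refl⟩∘⟨_
  infixl 5 _⟩∘⟨refl

  equaliser-mono : ∀ {E A B} {ι : Hom E A} {f g : Hom A B} → IsEqualiser {C = C} ι f g →
                   ∀ {Z} {v w : Hom Z E} → ι ∘ v ≈ ι ∘ w → v ≈ w
  equaliser-mono {ι = ι} {f} {g} eq {w = w} ιv≈ιw =
    ≈.trans (unique _ ιv≈ιw) (≈.sym (unique w ≈.refl))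
    where
    open IsEqualiser eq
    open HomReasoning
    ιw-forks : f ∘ (ι ∘ w) ≈ g ∘ (ι ∘ w)
    ιw-forks = begin
      f ∘ (ι ∘ w) ≈⟨ ≈.sym assoc ⟩
      (f ∘ ι) ∘ w ≈⟨ equality ⟩∘⟨refl ⟩
      (g ∘ ι) ∘ w ≈⟨ assoc ⟩
      g ∘ (ι ∘ w) ∎
    unique = proj₂ (proj₂ (universal (ι ∘ w) ιw-forks))

  split-equaliser : ∀ {E A B} {ι : Hom E A} {f g : Hom A B} (s : Hom A E) (t : Hom B A) →
                    f ∘ ι ≈ g ∘ ι → s ∘ ι ≈ id → t ∘ g ≈ id → t ∘ f ≈ ι ∘ s →
                    IsEqualiser {C = C} ι f g
  split-equaliser {ι = ι} {f} {g} s t fork sι≈id tg≈id tf≈ιs = record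
    { equality  = fork
    ; universal = λ h fh≈gh → s ∘ h , factorises h fh≈gh , unique h
    }
    where
    open HomReasoning
    factorises : ∀ {Z} (h : Hom Z _) → f ∘ h ≈ g ∘ h → ι ∘ (s ∘ h) ≈ h
    factorises h fh≈gh = begin
      ι ∘ (s ∘ h) ≈⟨ ≈.sym assoc ⟩
      (ι ∘ s) ∘ h ≈⟨ ≈.sym tf≈ιs ⟩∘⟨refl ⟩
      (t ∘ f) ∘ h ≈⟨ assoc ⟩
      t ∘ (f ∘ h) ≈⟨ refl⟩∘⟨ fh≈gh ⟩
      t ∘ (g ∘ h) ≈⟨ ≈.sym assoc ⟩
      (t ∘ g) ∘ h ≈⟨ tg≈id ⟩∘⟨refl ⟩
      id ∘ h      ≈⟨ identityˡ ⟩
      h           ∎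
    unique : ∀ {Z} (h : Hom Z _) (v : Hom Z _) → ι ∘ v ≈ h → v ≈ s ∘ h
    unique h v ιv≈h = begin
      v           ≈⟨ ≈.sym identityˡ ⟩
      id ∘ v      ≈⟨ ≈.sym sι≈id ⟩∘⟨refl ⟩
      (s ∘ ι) ∘ v ≈⟨ assoc ⟩
      s ∘ (ι ∘ v) ≈⟨ refl⟩∘⟨ ιv≈h ⟩
      s ∘ h       ∎

module MonadProperties {o ℓ e} {C : Category o ℓ e} (M : Monad C) where
  open Category C
  open Monad M
  open CategoryProperties C

  private
    module ≈ {A B} = IsEquivalence (≈-equiv {A} {B})

  F-∘-extension : ∀ {A B D} {c : Hom A (F₀ B)} (f : Hom B D) →
                  F₁ f ∘ (μ B ∘ F₁ c) ≈ μ D ∘ F₁ (F₁ f ∘ c)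
  F-∘-extension {B = B} {D} {c} f = begin
    F₁ f ∘ (μ B ∘ F₁ c)         ≈⟨ ≈.sym assoc ⟩
    (F₁ f ∘ μ B) ∘ F₁ c         ≈⟨ ≈.sym μ-natural ⟩∘⟨refl ⟩
    (μ D ∘ F₁ (F₁ f)) ∘ F₁ c    ≈⟨ assoc ⟩
    μ D ∘ (F₁ (F₁ f) ∘ F₁ c)    ≈⟨ refl⟩∘⟨ ≈.sym F-homomorphism ⟩
    μ D ∘ F₁ (F₁ f ∘ c)         ∎
    where open HomReasoning

  extension-fork : ∀ {A B D} {c : Hom A (F₀ B)} {f g : Hom B D} →
                   F₁ f ∘ c ≈ F₁ g ∘ c → F₁ f ∘ (μ B ∘ F₁ c) ≈ F₁ g ∘ (μ B ∘ F₁ c)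
  extension-fork {D = D} {c = c} {f} {g} fork = begin
    F₁ f ∘ (μ _ ∘ F₁ c) ≈⟨ F-∘-extension f ⟩
    μ D ∘ F₁ (F₁ f ∘ c) ≈⟨ refl⟩∘⟨ F-resp-≈ fork ⟩
    μ D ∘ F₁ (F₁ g ∘ c) ≈⟨ ≈.sym (F-∘-extension g) ⟩
    F₁ g ∘ (μ _ ∘ F₁ c) ∎
    where open HomReasoning

  module _ {X : Obj} where

    coalgebra-equaliser : ∀ {a : Hom (F₀ X) X} {b : Hom X (F₀ X)} → IsCoalgebraOn M a b →
                          IsEqualiser {C = C} b (F₁ b) (F₁ (η X))
    coalgebra-equaliser {a} co =
      split-equaliser a (μ X) (≈.sym coassoc) counit μ-identityˡ (≈.sym hom)
      where open IsCoalgebraOn co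

    coalgebra-determines-algebra : ∀ {a : Hom (F₀ X) X} {b : Hom X (F₀ X)} →
                                   IsCoalgebraOn M a b →
                                   ∀ (a′ : Hom (F₀ X) X) → b ∘ a′ ≈ μ X ∘ F₁ b → a′ ≈ a
    coalgebra-determines-algebra co a′ ba′≈μTb =
      equaliser-mono (coalgebra-equaliser co) (≈.trans ba′≈μTb (≈.sym hom))
      where open IsCoalgebraOn co

    module FromEqualiser {c : Hom X (F₀ X)} (eq : IsEqualiser {C = C} c (F₁ c) (F₁ (η X))) where
      open IsEqualiser eq
      open HomReasoning

      private
        factorisation = universal (μ X ∘ F₁ c) (extension-fork equality)
        cancel-c : ∀ {Z} {v w : Hom Z X} → c ∘ v ≈ c ∘ w → v ≈ w
        cancel-c = equaliser-mono eq

      algebra : Hom (F₀ X) X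
      algebra = proj₁ factorisation

      c∘algebra : c ∘ algebra ≈ μ X ∘ F₁ c
      c∘algebra = proj₁ (proj₂ factorisation)

      algebra-unique : ∀ (a′ : Hom (F₀ X) X) → c ∘ a′ ≈ μ X ∘ F₁ c → a′ ≈ algebra
      algebra-unique = proj₂ (proj₂ factorisation)

      private
        c∘algebra∘ : ∀ {Z} (h : Hom Z (F₀ X)) → c ∘ (algebra ∘ h) ≈ μ X ∘ (F₁ c ∘ h)
        c∘algebra∘ h = begin
          c ∘ (algebra ∘ h)   ≈⟨ ≈.sym assoc ⟩
          (c ∘ algebra) ∘ h   ≈⟨ c∘algebra ⟩∘⟨refl ⟩
          (μ X ∘ F₁ c) ∘ h    ≈⟨ assoc ⟩
          μ X ∘ (F₁ c ∘ h)    ∎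

      algebra-counit : algebra ∘ c ≈ id
      algebra-counit = cancel-c (begin
        c ∘ (algebra ∘ c)       ≈⟨ c∘algebra∘ c ⟩
        μ X ∘ (F₁ c ∘ c)        ≈⟨ refl⟩∘⟨ equality ⟩
        μ X ∘ (F₁ (η X) ∘ c)    ≈⟨ ≈.sym assoc ⟩
        (μ X ∘ F₁ (η X)) ∘ c    ≈⟨ μ-identityˡ ⟩∘⟨refl ⟩
        id ∘ c                  ≈⟨ identityˡ ⟩
        c                       ≈⟨ ≈.sym identityʳ ⟩
        c ∘ id                  ∎)

      algebra-unit : algebra ∘ η X ≈ id
      algebra-unit = cancel-c (begin
        c ∘ (algebra ∘ η X)     ≈⟨ c∘algebra∘ (η X) ⟩
        μ X ∘ (F₁ c ∘ η X)      ≈⟨ refl⟩∘⟨ ≈.sym η-natural ⟩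
        μ X ∘ (η (F₀ X) ∘ c)    ≈⟨ ≈.sym assoc ⟩
        (μ X ∘ η (F₀ X)) ∘ c    ≈⟨ μ-identityʳ ⟩∘⟨refl ⟩
        id ∘ c                  ≈⟨ identityˡ ⟩
        c                       ≈⟨ ≈.sym identityʳ ⟩
        c ∘ id                  ∎)

      algebra-mult : algebra ∘ F₁ algebra ≈ algebra ∘ μ X
      algebra-mult = cancel-c (begin
        c ∘ (algebra ∘ F₁ algebra)          ≈⟨ c∘algebra∘ (F₁ algebra) ⟩
        μ X ∘ (F₁ c ∘ F₁ algebra)           ≈⟨ refl⟩∘⟨ ≈.sym F-homomorphism ⟩
        μ X ∘ F₁ (c ∘ algebra)              ≈⟨ refl⟩∘⟨ F-resp-≈ c∘algebra ⟩
        μ X ∘ F₁ (μ X ∘ F₁ c)               ≈⟨ refl⟩∘⟨ F-homomorphism ⟩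
        μ X ∘ (F₁ (μ X) ∘ F₁ (F₁ c))        ≈⟨ ≈.sym assoc ⟩
        (μ X ∘ F₁ (μ X)) ∘ F₁ (F₁ c)        ≈⟨ μ-assoc ⟩∘⟨refl ⟩
        (μ X ∘ μ (F₀ X)) ∘ F₁ (F₁ c)        ≈⟨ assoc ⟩
        μ X ∘ (μ (F₀ X) ∘ F₁ (F₁ c))        ≈⟨ refl⟩∘⟨ μ-natural ⟩
        μ X ∘ (F₁ c ∘ μ X)                  ≈⟨ ≈.sym (c∘algebra∘ (μ X)) ⟩
        c ∘ (algebra ∘ μ X)                 ∎)

      isAlgebra : IsAlgebra M algebra
      isAlgebra = record { unit = algebra-unit ; mult = algebra-mult }

      isCoalgebraOn : IsCoalgebraOn M algebra c
      isCoalgebraOn = record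
        { hom = c∘algebra ; counit = algebra-counit ; coassoc = ≈.sym equality }

lemma2p3 : ∀ {o ℓ e} (C : Category o ℓ e) (M : Monad C) (X : Category.Obj C) →
    let open Category C
        open Monad M
    in
    (∀ (a : Hom (F₀ X) X) (b : Hom X (F₀ X)) →
       IsAlgebra M a → IsCoalgebraOn M a b →
       IsEqualiser {C = C} b (F₁ b) (F₁ (η X))
       × (∀ (a′ : Hom (F₀ X) X) → b ∘ a′ ≈ μ X ∘ F₁ b → a′ ≈ a))
    ×
    (∀ (c : Hom X (F₀ X)) →
       IsEqualiser {C = C} c (F₁ c) (F₁ (η X)) →
       Σ (Hom (F₀ X) X) λ a →
         (c ∘ a ≈ μ X ∘ F₁ c)
         × (∀ (a′ : Hom (F₀ X) X) → c ∘ a′ ≈ μ X ∘ F₁ c → a′ ≈ a)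
         × IsAlgebra M a
         × IsCoalgebraOn M a c)
lemma2p3 C M X =
  (λ a b _ co → coalgebra-equaliser co , coalgebra-determines-algebra co)
  , λ c eq → let open FromEqualiser eq in
      algebra , c∘algebra , algebra-unique , isAlgebra , isCoalgebraOn
  where open MonadProperties M
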